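{- Let $t\ge 1$. If a graph $G$ has a dominating $K_t$-model, then $G$ has a path $v_1,\dots,v_t$ such that $\deg_G(v_t)\geq t-1$ and $\deg_G(v_i)\geq i$ for all $1\leq i\leq t-1$.
   Context: A dominating $K_t$-model in a graph $G$ is a sequence $(T_1,\dots,T_t)$ of pairwise disjoint non-empty connected subgraphs of $G$ such that for all $1\le i<j\le t$, every vertex of $T_j$ has a neighbour in $T_i$. -}

module Defs where

open import Data.Nat using (ℕ; suc; _+_; _<_; _≤_; _∸_)
open import Data.Fin using (Fin; toℕ)
open import Data.Bool using (Bool; true; false; T)
open import Data.List using (length; filterᵇ; allFin)
open import Data.Product using (Σ; ∃; _×_; _,_)
open import Data.Empty using (⊥)
open import Relation.Binary.PropositionalEquality using (_≡_)
open import Function.Definitions using (Injective)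

record Graph (n : ℕ) : Set where
  field
    Adj   : Fin n → Fin n → Bool
    sym   : ∀ u v → Adj u v ≡ Adj v u
    loopless : ∀ v → Adj v v ≡ false
open Graph public

deg : ∀ {n} → Graph n → Fin n → ℕ
deg G v = length (filterᵇ (Adj G v) (allFin _))

VSet : ℕ → Set
VSet n = Fin n → Bool

_∈ᵥ_ : ∀ {n} → Fin n → VSet n → Set
v ∈ᵥ S = T (S v)

data WalkIn {n} (G : Graph n) (S : VSet n) : Fin n → Fin n → Set where
  here : ∀ {u} → u ∈ᵥ S → WalkIn G S u u
  step : ∀ {u w v} → u ∈ᵥ S → T (Adj G u w) → WalkIn G S w v → WalkIn G S u v

NonEmptyConnected : ∀ {n} → Graph n → VSet n → Set
NonEmptyConnected G S =
  (∃ λ v → v ∈ᵥ S) × (∀ u v → u ∈ᵥ S → v ∈ᵥ S → WalkIn G S u v)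

-- dominating K_t-model (T_1,...,T_t), indexed by Fin t (0-based)
DominatingModel : ∀ {n} → Graph n → (t : ℕ) → (Fin t → VSet n) → Set
DominatingModel G t Ts =
  (∀ i → NonEmptyConnected G (Ts i)) ×
  (∀ i j → toℕ i < toℕ j → ∀ v → v ∈ᵥ Ts i → v ∈ᵥ Ts j → ⊥) ×
  (∀ i j → toℕ i < toℕ j → ∀ v → v ∈ᵥ Ts j →
      ∃ λ w → w ∈ᵥ Ts i × T (Adj G v w))

HasDominatingModel : ∀ {n} → Graph n → ℕ → Set
HasDominatingModel G t = ∃ λ (Ts : Fin t → VSet _) → DominatingModel G t Ts

-- a path v_1,...,v_t given as an injective map p : Fin t → Fin n (0-based),
-- consecutive vertices adjacent
IsPath : ∀ {n t} → Graph n → (Fin t → Fin n) → Set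
IsPath {t = t} G p =
  Injective _≡_ _≡_ p ×
  (∀ i j → suc (toℕ i) ≡ toℕ j → T (Adj G (p i) (p j)))

{-# OPTIONS --safe #-}
module Submission where

-- Take v_t in T_t and, going down, let v_i be a neighbour of v_{i+1} in T_i.
-- Since v_i ∈ T_i and the T_i are disjoint, this is a path. By domination
-- v_i has a neighbour in every T_j with j < i, and for i < t also the
-- neighbour v_{i+1} ∈ T_{i+1}; lying in distinct T's these neighbours are
-- distinct, so deg v_i ≥ i for i < t and deg v_t ≥ t - 1.

open import Defs hiding (sym)
open import Data.Nat using (ℕ; zero; suc; _<_; _≤_; _∸_; z≤n; s≤s; s≤s⁻¹)
open import Data.Nat.Properties using (≤-refl; ≤-reflexive; ≤-trans; m≤n⇒m≤1+n; suc-injective)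
open import Data.Fin using (Fin; toℕ; fromℕ; inject₁; inject≤; punchIn)
  renaming (zero to fzero; suc to fsuc)
open import Data.Fin.Properties
  using (injective⇒≤; toℕ-inject₁; toℕ-inject≤; toℕ<n; inject≤-injective; punchIn-injective; <-cmp)
open import Data.Bool using (T)
open import Data.Bool.Properties using (T?)
open import Data.List using (List; filterᵇ; allFin; lookup)
open import Data.List.Relation.Unary.Any using (index)
open import Data.List.Relation.Unary.Any.Properties using (lookup-index)
open import Data.List.Membership.Propositional using (_∈_)
open import Data.List.Membership.Propositional.Properties using (∈-filter⁺; ∈-allFin)
open import Data.Product using (∃; _×_; _,_; proj₁; proj₂)
open import Data.Sum using (_⊎_; inj₁; inj₂)
open import Data.Empty using (⊥; ⊥-elim)
open import Relation.Binary using (tri<; tri≈; tri>)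
open import Relation.Binary.PropositionalEquality using (_≡_; refl; sym; cong; subst; module ≡-Reasoning)
open import Function.Definitions using (Injective)

Adj-sym : ∀ {n} (G : Graph n) {u v} → T (Adj G u v) → T (Adj G v u)
Adj-sym G {u} {v} = subst T (Graph.sym G u v)

injective-neighbours⇒≤-deg : ∀ {n k} (G : Graph n) v (f : Fin k → Fin n) →
  Injective _≡_ _≡_ f → (∀ j → T (Adj G v (f j))) → k ≤ deg G v
injective-neighbours⇒≤-deg {n} G v f f-injective f-adjacent = injective⇒≤ position-injective
  where
  neighbours : List (Fin n)
  neighbours = filterᵇ (Adj G v) (allFin n)

  f∈neighbours : ∀ j → f j ∈ neighbours
  f∈neighbours j = ∈-filter⁺ (λ x → T? (Adj G v x)) (∈-allFin (f j)) (f-adjacent j)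

  position-injective : Injective _≡_ _≡_ (λ j → index (f∈neighbours j))
  position-injective {a} {b} same-position = f-injective (begin
    f a                                        ≡⟨ lookup-index (f∈neighbours a) ⟩
    lookup neighbours (index (f∈neighbours a)) ≡⟨ cong (lookup neighbours) same-position ⟩
    lookup neighbours (index (f∈neighbours b)) ≡⟨ sym (lookup-index (f∈neighbours b)) ⟩
    f b                                        ∎)
    where open ≡-Reasoning

inject₁-suc⇒consecutive : ∀ {m} (R : Fin (suc m) → Fin (suc m) → Set) →
  (∀ k → R (inject₁ k) (fsuc k)) → ∀ i j → suc (toℕ i) ≡ toℕ j → R i j
inject₁-suc⇒consecutive R R-step fzero (fsuc fzero) refl = R-step fzero
inject₁-suc⇒consecutive {suc m} R R-step (fsuc i) (fsuc j) i+1≡j =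
  inject₁-suc⇒consecutive (λ a b → R (fsuc a) (fsuc b)) (λ k → R-step (fsuc k))
    i j (suc-injective i+1≡j)

punchIn-below-or-next : ∀ {m} (i : Fin (suc m)) (j : Fin m) → toℕ j ≤ toℕ i →
  toℕ (punchIn i j) < toℕ i ⊎ toℕ (punchIn i j) ≡ suc (toℕ i)
punchIn-below-or-next fzero    fzero    z≤n       = inj₂ refl
punchIn-below-or-next (fsuc i) fzero    _         = inj₁ (s≤s z≤n)
punchIn-below-or-next (fsuc i) (fsuc j) (s≤s j≤i) with punchIn-below-or-next i j j≤i
... | inj₁ below = inj₁ (s≤s below)
... | inj₂ next  = inj₂ (cong suc next)

descending-walk : ∀ {n m} (G : Graph n) (S : Fin (suc m) → VSet n) →
  (∃ λ v → v ∈ᵥ S (fromℕ m)) →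
  (∀ (i : Fin m) v → v ∈ᵥ S (fsuc i) → ∃ λ w → w ∈ᵥ S (inject₁ i) × T (Adj G v w)) →
  ∃ λ (p : Fin (suc m) → Fin n) →
    (∀ i → p i ∈ᵥ S i) × (∀ (i : Fin m) → T (Adj G (p (fsuc i)) (p (inject₁ i))))
descending-walk {m = zero} G S (v , v∈top) _ = (λ _ → v) , (λ { fzero → v∈top }) , (λ ())
descending-walk {n} {suc m} G S top descend
  with descending-walk G (λ i → S (fsuc i)) top (λ i → descend (fsuc i))
... | q , q∈S , q-step with descend fzero (q fzero) (q∈S fzero)
... | w , w∈S₀ , q₀~w = p , p∈S , p-step
  where
  p : Fin (suc (suc m)) → Fin n
  p fzero    = w
  p (fsuc i) = q i

  p∈S : ∀ i → p i ∈ᵥ S i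
  p∈S fzero    = w∈S₀
  p∈S (fsuc i) = q∈S i

  p-step : ∀ i → T (Adj G (p (fsuc i)) (p (inject₁ i)))
  p-step fzero    = q₀~w
  p-step (fsuc i) = q-step i

module Disjoint {n t} (Ts : Fin t → VSet n)
  (disjoint : ∀ i j → toℕ i < toℕ j → ∀ v → v ∈ᵥ Ts i → v ∈ᵥ Ts j → ⊥) where

  ∈-both⇒≡ : ∀ {a b v} → v ∈ᵥ Ts a → v ∈ᵥ Ts b → a ≡ b
  ∈-both⇒≡ {a} {b} {v} v∈a v∈b with <-cmp a b
  ... | tri< a<b _ _ = ⊥-elim (disjoint a b a<b v v∈a v∈b)
  ... | tri≈ _ a≡b _ = a≡b
  ... | tri> _ _ b<a = ⊥-elim (disjoint b a b<a v v∈b v∈a)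

  section-injective : ∀ {k} {ℓ : Fin k → Fin t} {f : Fin k → Fin n} →
    Injective _≡_ _≡_ ℓ → (∀ j → f j ∈ᵥ Ts (ℓ j)) → Injective _≡_ _≡_ f
  section-injective {ℓ = ℓ} ℓ-injective f∈Ts {a} {b} fa≡fb =
    ℓ-injective (∈-both⇒≡ (f∈Ts a) (subst (_∈ᵥ Ts (ℓ b)) (sym fa≡fb) (f∈Ts b)))

  neighbours-in-levels⇒≤-deg : ∀ {k} (G : Graph n) v (ℓ : Fin k → Fin t) →
    Injective _≡_ _≡_ ℓ → (∀ j → ∃ λ w → w ∈ᵥ Ts (ℓ j) × T (Adj G v w)) → k ≤ deg G v
  neighbours-in-levels⇒≤-deg G v ℓ ℓ-injective neighbour =
    injective-neighbours⇒≤-deg G v (λ j → proj₁ (neighbour j))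
      (section-injective ℓ-injective (λ j → proj₁ (proj₂ (neighbour j))))
      (λ j → proj₂ (proj₂ (neighbour j)))

module DominatingPath {n m} (G : Graph n) (Ts : Fin (suc m) → VSet n)
  (nonEmptyConnected : ∀ i → NonEmptyConnected G (Ts i))
  (disjoint : ∀ i j → toℕ i < toℕ j → ∀ v → v ∈ᵥ Ts i → v ∈ᵥ Ts j → ⊥)
  (dominating : ∀ i j → toℕ i < toℕ j → ∀ v → v ∈ᵥ Ts j →
      ∃ λ w → w ∈ᵥ Ts i × T (Adj G v w)) where

  open Disjoint Ts disjoint

  top : ∃ λ v → v ∈ᵥ Ts (fromℕ m)
  top = proj₁ (nonEmptyConnected (fromℕ m))

  descend : ∀ (i : Fin m) v → v ∈ᵥ Ts (fsuc i) →
    ∃ λ w → w ∈ᵥ Ts (inject₁ i) × T (Adj G v w)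
  descend i = dominating (inject₁ i) (fsuc i) (s≤s (≤-reflexive (toℕ-inject₁ i)))

  p : Fin (suc m) → Fin n
  p = proj₁ (descending-walk G Ts top descend)

  p∈Ts : ∀ i → p i ∈ᵥ Ts i
  p∈Ts = proj₁ (proj₂ (descending-walk G Ts top descend))

  p-step : ∀ (i : Fin m) → T (Adj G (p (fsuc i)) (p (inject₁ i)))
  p-step = proj₂ (proj₂ (descending-walk G Ts top descend))

  p-path : IsPath G p
  p-path = section-injective (λ eq → eq) p∈Ts
         , inject₁-suc⇒consecutive (λ i j → T (Adj G (p i) (p j)))
             (λ k → Adj-sym G (p-step k))

  neighbour-at : ∀ i l → toℕ l < toℕ i ⊎ toℕ l ≡ suc (toℕ i) →
    ∃ λ w → w ∈ᵥ Ts l × T (Adj G (p i) w)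
  neighbour-at i l (inj₁ l<i)   = dominating l i l<i (p i) (p∈Ts i)
  neighbour-at i l (inj₂ l≡i+1) = p l , p∈Ts l , proj₂ p-path i l (sym l≡i+1)

  -- punchIn i sends {0, …, i} to the levels below i together with i + 1.
  ≤-deg : ∀ i {k} → k ≤ m → k ≤ suc (toℕ i) → k ≤ deg G (p i)
  ≤-deg i {k} k≤m k≤i+1 = neighbours-in-levels⇒≤-deg G (p i) level level-injective
    (λ j → neighbour-at i (level j) (punchIn-below-or-next i (inject≤ j k≤m) (level-bound j)))
    where
    level : Fin k → Fin (suc m)
    level j = punchIn i (inject≤ j k≤m)

    level-injective : Injective _≡_ _≡_ level
    level-injective {a} {b} eq =
      inject≤-injective k≤m k≤m a b (punchIn-injective i _ _ eq)

    level-bound : ∀ j → toℕ (inject≤ j k≤m) ≤ toℕ i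
    level-bound j = ≤-trans (≤-reflexive (toℕ-inject≤ j k≤m))
                            (s≤s⁻¹ (≤-trans (toℕ<n j) k≤i+1))

lemma4 : ∀ {n} (G : Graph n) (t : ℕ) → 1 ≤ t → HasDominatingModel G t →
         ∃ λ (p : Fin t → Fin n) → IsPath G p ×
           (∀ i → toℕ i ≡ t ∸ 1 → t ∸ 1 ≤ deg G (p i)) ×
           (∀ i → suc (toℕ i) < t → suc (toℕ i) ≤ deg G (p i))
lemma4 G zero () _
lemma4 G (suc m) _ (Ts , nonEmptyConnected , disjoint , dominating) =
  p , p-path
    , (λ i i≡m → ≤-deg i ≤-refl (m≤n⇒m≤1+n (≤-reflexive (sym i≡m))))
    , (λ i i+1<t → ≤-deg i (s≤s⁻¹ i+1<t) ≤-refl)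
  where open DominatingPath G Ts nonEmptyConnected disjoint dominating
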